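{- Let $F=\langle W,R,\{S_x\}_{x\in W}\rangle$ be any $\mathbf{ILS}$-frame. Then the schema $\mathbf{J4}$: $A\rhd B\to(\Diamond A\to\Diamond B)$ is valid in $F$ if and only if for all $x,y\in W$ and all $V\subseteq W$, if $yS_xV$ then there exists $z\in V$ with $xRz$.
   Context: Formulas are built from propositional variables, $\top,\bot$, $\neg,\land,\lor,\to$, unary $\Box$ and binary $\rhd$; $\Diamond A$ abbreviates $\neg\Box\neg A$. An $\mathbf{ILS}$-frame is a triple $\langle W,R,\{S_x\}_{x\in W}\rangle$ with $W$ nonempty, $R$ transitive and conversely well-founded on $W$, each $S_x\subseteq W\times(\mathcal P(W)\setminus\{\emptyset\})$ such that $yS_xV$ implies $xRy$, and (monotonicity) $yS_xV$ and $V\subseteq U$ imply $yS_xU$. Satisfaction: usual Boolean clauses, $x\Vdash\Box A$ iff $y\Vdash A$ for all $y$ with $xRy$, and $x\Vdash A\rhd B$ iff for every $y$ with $xRy$ and $y\Vdash A$ there is $V\subseteq W$ with $yS_xV$ and $z\Vdash B$ for all $z\in V$. A schema is valid in a frame if every instance holds at every point under every satisfaction relation. -}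

module Defs where

open import Level using (Level; 0ℓ; suc; Lift)
open import Data.Nat using (ℕ)
open import Data.Product using (Σ; ∃; _×_; _,_)
open import Data.Sum using (_⊎_)
open import Data.Unit using (⊤)
open import Data.Empty using (⊥)
open import Relation.Nullary using (¬_)
open import Relation.Unary using (Pred; _⊆_; _∈_)
open import Relation.Binary using (Rel; Transitive)
open import Function using (flip)
open import Induction.WellFounded using (WellFounded)

data Fm : Set where
  var  : ℕ → Fm
  ⊤'   : Fm
  ⊥'   : Fm
  ¬'_  : Fm → Fm
  _∧'_ : Fm → Fm → Fm
  _∨'_ : Fm → Fm → Fm
  _→'_ : Fm → Fm → Fm
  □_   : Fm → Fm
  _▷_  : Fm → Fm → Fm

◇_ : Fm → Fm
◇ A = ¬' (□ (¬' A))

Nonempty : {W : Set} → Pred W 0ℓ → Set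
Nonempty {W} V = Σ W λ z → z ∈ V

-- ILS-frames: W nonempty, R transitive and conversely well-founded,
-- S x y V meaning y S_x V, with V ⊆ W nonempty, y S_x V ⇒ x R y,
-- and monotonicity in V.
record ILSFrame : Set₁ where
  field
    W        : Set
    inhabited : W
    R        : Rel W 0ℓ
    S        : W → W → Pred W 0ℓ → Set
    R-trans  : Transitive R
    R-cwf    : WellFounded (flip R)
    S-nonempty : ∀ {x y V} → S x y V → Nonempty V
    S-R      : ∀ {x y V} → S x y V → R x y
    S-mono   : ∀ {x y V U} → S x y V → V ⊆ U → S x y U

module _ (F : ILSFrame) where
  open ILSFrame F

  Valuation : Set₁
  Valuation = ℕ → Pred W 0ℓ

  -- Forcing x ⊩ A under valuation v (Set₁-valued since ▷ quantifies over subsets)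
  sat : Valuation → W → Fm → Set₁
  sat v x (var p) = Lift _ (v p x)
  sat v x ⊤' = Lift _ ⊤
  sat v x ⊥' = Lift _ ⊥
  sat v x (¬' A) = ¬ sat v x A
  sat v x (A ∧' B) = sat v x A × sat v x B
  sat v x (A ∨' B) = sat v x A ⊎ sat v x B
  sat v x (A →' B) = sat v x A → sat v x B
  sat v x (□ A) = ∀ y → R x y → sat v y A
  sat v x (A ▷ B) = ∀ y → R x y → sat v y A →
                      Σ (Pred W 0ℓ) λ V → S x y V × (∀ z → z ∈ V → sat v z B)

  ValidSchema₂ : (Fm → Fm → Fm) → Set₁
  ValidSchema₂ φ = ∀ (v : Valuation) (A B : Fm) (x : W) → sat v x (φ A B)

J4 : Fm → Fm → Fm
J4 A B = (A ▷ B) →' ((◇ A) →' (◇ B))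

-- Soundness (condition ⇒ J4 valid) is constructive: if x ⊩ A ▷ B and
-- xRy ⊩ A, then y S_x V for some V ⊩ B, the condition yields z ∈ V with
-- xRz, and z ⊩ B witnesses x ⊩ ◇B.
--
-- Completeness (J4 valid ⇒ condition) uses a canonical valuation: given
-- y S_x V, make p₀ true exactly on V and p₁ true exactly at y.  Then
-- x ⊩ p₁ ▷ p₀ and x ⊩ ◇p₁, so validity of J4 gives x ⊩ ◇p₀.  Forcing of
-- ◇p₀ only says that an R-successor of x in V is not impossible; excluded
-- middle (as double-negation elimination) turns this into a witness.
module Submission where

open import Defs
open import Level using (0ℓ; suc; Lift; lift; lower)
open import Data.Nat using (zero) renaming (suc to nsuc)
open import Data.Product using (Σ; _×_; _,_)
open import Relation.Unary using (Pred; _∈_)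
open import Relation.Nullary using (¬_)
open import Relation.Binary.PropositionalEquality using (_≡_; refl)
open import Axiom.ExcludedMiddle using (ExcludedMiddle)
open import Axiom.DoubleNegationElimination using (em⇒dne)

module _ (F : ILSFrame) where
  open ILSFrame F

  Reaches : W → Pred W 0ℓ → Set
  Reaches x V = Σ W λ z → z ∈ V × R x z

  J4Condition : Set₁
  J4Condition = ∀ (x y : W) (V : Pred W 0ℓ) → S x y V → Reaches x V

  ◇-intro : ∀ {v x y} A → R x y → sat F v y A → sat F v x (◇ A)
  ◇-intro A rxy yA x⊩□¬A = x⊩□¬A _ rxy yA

  ◇-var-reaches : ∀ {v x} p → sat F v x (◇ var p) → ¬ ¬ Reaches x (v p)
  ◇-var-reaches p x⊩◇p noReach =
    x⊩◇p λ z rxz zp → noReach (z , lower zp , rxz)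

  J4-sound : J4Condition → ValidSchema₂ F J4
  J4-sound cond v A B x x⊩A▷B x⊩◇A x⊩□¬B =
    x⊩◇A λ y rxy yA →
      let (V , ySV , V⊩B) = x⊩A▷B y rxy yA
          (z , zV , rxz)  = cond x y V ySV
      in ◇-intro B rxz (V⊩B z zV) x⊩□¬B

  canonical : W → Pred W 0ℓ → Valuation F
  canonical y V zero     = V
  canonical y V (nsuc _) = λ w → w ≡ y

  p₀ p₁ : Fm
  p₀ = var 0
  p₁ = var 1

  J4-instance-reaches : ∀ {x y V} → S x y V →
    sat F (canonical y V) x (J4 p₁ p₀) → ¬ ¬ Reaches x V
  J4-instance-reaches {x} {y} {V} ySV x⊩J4 =
    ◇-var-reaches {ν} 0 (x⊩J4 x⊩p₁▷p₀ (◇-intro {ν} p₁ (S-R ySV) (lift refl)))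
    where
    ν : Valuation F
    ν = canonical y V

    x⊩p₁▷p₀ : sat F ν x (p₁ ▷ p₀)
    x⊩p₁▷p₀ .y _ (lift refl) = V , ySV , λ z zV → lift zV

  J4-complete : ExcludedMiddle (suc 0ℓ) → ValidSchema₂ F J4 → J4Condition
  J4-complete em valid x y V ySV =
    lower (em⇒dne em λ noReach →
      J4-instance-reaches ySV (valid (canonical y V) p₁ p₀ x)
        λ reach → noReach (lift reach))

proposition3p9 : ExcludedMiddle (suc 0ℓ) → (F : ILSFrame) →
    let open ILSFrame F in
    (ValidSchema₂ F J4 → (∀ (x y : W) (V : Pred W 0ℓ) → S x y V → Σ W λ z → z ∈ V × R x z))
    × ((∀ (x y : W) (V : Pred W 0ℓ) → S x y V → Σ W λ z → z ∈ V × R x z) → ValidSchema₂ F J4)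
proposition3p9 em F = J4-complete F em , J4-sound F
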